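{- Let $\mathcal{P} = (\mathcal{X}, C)$ denote a program over $(A, \sqsubseteq)$. For any unfolding $(\mathcal{P}', \kappa)$ of $\mathcal{P}$, we have $\vec{\kappa}(\mathrm{MFP}(\mathcal{P}')) \ \sqsubseteq \ \mathrm{MFP}(\mathcal{P})$.
   Context: $(A, \sqsubseteq)$ is a complete lattice; functions into $A$ are ordered pointwise. A program is $\mathcal{P} = (\mathcal{X}, C)$ with $\mathcal{X}$ a finite set of variables and $C$ a finite set of commands $\langle X_1, \ldots, X_n ; f ; X \rangle$ (pairwise distinct inputs, monotonic $f \in A^n \rightarrow A$, output $X$). A valuation is $\rho \in \mathcal{X} \rightarrow A$; the command semantics is $[\![c]\!](\rho)(X) = f(\rho(X_1), \ldots, \rho(X_n))$ and $[\![c]\!](\rho)(Y) = \rho(Y)$ for $Y \neq X$. $\mathrm{MFP}(\mathcal{P})$ is the greatest lower bound of all valuations $\rho$ with $[\![c]\!](\rho) \sqsubseteq \rho$ for all $c \in C$. An unfolding of $\mathcal{P}$ is a pair $(\mathcal{P}', \kappa)$ with $\mathcal{P}' = (\mathcal{X}', C')$ a program and $\kappa \in \mathcal{X}' \rightarrow \mathcal{X}$ a variable renaming such that $\langle \kappa(X'_1), \ldots, \kappa(X'_n) ; f ; \kappa(X') \rangle \in C$ for every $\langle X'_1, \ldots, X'_n ; f ; X' \rangle \in C'$. The map $\vec{\kappa} : (\mathcal{X}' \rightarrow A) \rightarrow (\mathcal{X} \rightarrow A)$ is defined by $\vec{\kappa}(\rho')(X) = \bigsqcup_{\kappa(X')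 = X} \rho'(X')$. -}

module Defs where

open import Level using (Level; _⊔_; suc; Lift; lift)
open import Data.Nat using (ℕ)
open import Data.Fin using (Fin; _≟_)
open import Data.Vec using (Vec; map)
open import Data.Vec.Relation.Unary.Unique.Propositional using (Unique)
import Data.Vec.Relation.Binary.Pointwise.Inductive as VP
open import Data.List using (List)
open import Data.List.Membership.Propositional using (_∈_)
open import Data.Product using (Σ; _×_; _,_)
open import Relation.Binary.PropositionalEquality using (_≡_)
open import Relation.Binary.Bundles using (Poset)
open import Relation.Nullary using (yes; no)

record CompleteLattice (c ℓ₁ ℓ₂ : Level) : Set (suc (c ⊔ ℓ₁ ⊔ ℓ₂)) where
  field
    poset : Poset c ℓ₁ ℓ₂
  open Poset poset public
  field
    ⨆ : {I : Set (c ⊔ ℓ₂)} → (I → Carrier) → Carrier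
    ⨆-upper : {I : Set (c ⊔ ℓ₂)} (g : I → Carrier) (i : I) → g i ≤ ⨆ g
    ⨆-least : {I : Set (c ⊔ ℓ₂)} (g : I → Carrier) (z : Carrier) →
              (∀ i → g i ≤ z) → ⨆ g ≤ z
    ⨅ : {I : Set (c ⊔ ℓ₂)} → (I → Carrier) → Carrier
    ⨅-lower : {I : Set (c ⊔ ℓ₂)} (g : I → Carrier) (i : I) → ⨅ g ≤ g i
    ⨅-greatest : {I : Set (c ⊔ ℓ₂)} (g : I → Carrier) (z : Carrier) →
                 (∀ i → z ≤ g i) → z ≤ ⨅ g

module _ {c ℓ₁ ℓ₂ : Level} (L : CompleteLattice c ℓ₁ ℓ₂) where
  open CompleteLattice L

  record Command (n : ℕ) : Set c where
    constructor ⟨_⨾_⨾_⟩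
    field
      {arity} : ℕ
      inputs  : Vec (Fin n) arity
      fun     : Vec Carrier arity → Carrier
      output  : Fin n
  open Command public

  Monotone : ∀ {k} → (Vec Carrier k → Carrier) → Set (c ⊔ ℓ₂)
  Monotone f = ∀ {u v} → VP.Pointwise _≤_ u v → f u ≤ f v

  record Program : Set c where
    field
      nVars    : ℕ
      commands : List (Command nVars)
  open Program public

  WellFormed : Program → Set (c ⊔ ℓ₂)
  WellFormed P = ∀ {cmd} → cmd ∈ commands P →
                 Unique (inputs cmd) × Monotone (fun cmd)

  Valuation : ℕ → Set c
  Valuation n = Fin n → Carrier

  _⊑ᵥ_ : ∀ {n} → Valuation n → Valuation n → Set ℓ₂
  ρ ⊑ᵥ σ = ∀ X → ρ X ≤ σ X

  ⟦_⟧ : ∀ {n} → Command n → Valuation n → Valuation n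
  ⟦ cmd ⟧ ρ Y with Y ≟ output cmd
  ... | yes _ = fun cmd (map ρ (inputs cmd))
  ... | no  _ = ρ Y

  PostFixed : (P : Program) → Valuation (nVars P) → Set (c ⊔ ℓ₂)
  PostFixed P ρ = ∀ {cmd} → cmd ∈ commands P → ⟦ cmd ⟧ ρ ⊑ᵥ ρ

  MFP : (P : Program) → Valuation (nVars P)
  MFP P X = ⨅ {I = Σ (Valuation (nVars P)) (PostFixed P)} (λ { (ρ , _) → ρ X })

  rename : ∀ {n m} → (Fin m → Fin n) → Command m → Command n
  rename κ ⟨ ins ⨾ f ⨾ X ⟩ = ⟨ map κ ins ⨾ f ⨾ κ X ⟩

  IsUnfolding : (P P' : Program) → (Fin (nVars P') → Fin (nVars P)) → Set c
  IsUnfolding P P' κ = ∀ {cmd'} → cmd' ∈ commands P' → rename κ cmd' ∈ commands P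

  κ⃗ : ∀ {n m} → (Fin m → Fin n) → Valuation m → Valuation n
  κ⃗ κ ρ' X = ⨆ {I = Lift (c ⊔ ℓ₂) (Σ (Fin _) (λ X' → κ X' ≡ X))}
                (λ { (lift (X' , _)) → ρ' X' })

module Submission where

-- Idea: MFP(𝒫) is the meet of the post-fixed valuations of 𝒫, and κ⃗ is
-- the lower adjoint of precomposition with κ: κ⃗(ρ') ⊑ ρ holds iff
-- ρ' ⊑ ρ ∘ κ.  So it suffices to show MFP(𝒫') ⊑ ρ ∘ κ for every
-- post-fixed ρ of 𝒫, and since MFP(𝒫') lies below every post-fixed
-- valuation of 𝒫', it suffices that ρ ∘ κ is post-fixed for 𝒫'.
-- That is the heart of the proof: each command c' of 𝒫' is the renaming
-- of a command of 𝒫, and a valuation is post-fixed for a single command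
-- exactly when the command's value at its inputs lies below the value of
-- its output, a condition that transports along κ.

open import Defs
open import Level using (Level; lift)
open import Function using (_∘_)
open import Data.Fin using (Fin; _≟_)
open import Data.Vec using (map)
open import Data.Vec.Properties using (map-∘)
open import Data.Product using (_,_)
open import Relation.Binary.PropositionalEquality
  using (_≡_; refl; sym; subst)
open import Relation.Nullary using (yes; no; contradiction)

module _ {c ℓ₁ ℓ₂ : Level} (L : CompleteLattice c ℓ₁ ℓ₂) where
  open CompleteLattice L renaming (refl to ≤-refl)

  ⟦⟧-at-output : ∀ {n} (cmd : Command L n) (ρ : Valuation L n) →
                 ⟦_⟧ L cmd ρ (output cmd) ≡ fun cmd (map ρ (inputs cmd))
  ⟦⟧-at-output cmd ρ with output cmd ≟ output cmd
  ... | yes _ = refl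
  ... | no ne = contradiction refl ne

  post-fixed⇒output-bound : ∀ {n} (cmd : Command L n) (ρ : Valuation L n) →
                            _⊑ᵥ_ L (⟦_⟧ L cmd ρ) ρ →
                            fun cmd (map ρ (inputs cmd)) ≤ ρ (output cmd)
  post-fixed⇒output-bound cmd ρ post =
    subst (_≤ ρ (output cmd)) (⟦⟧-at-output cmd ρ) (post (output cmd))

  output-bound⇒post-fixed : ∀ {n} (cmd : Command L n) (ρ : Valuation L n) →
                            fun cmd (map ρ (inputs cmd)) ≤ ρ (output cmd) →
                            _⊑ᵥ_ L (⟦_⟧ L cmd ρ) ρ
  output-bound⇒post-fixed cmd ρ bound Y with Y ≟ output cmd
  ... | yes refl = bound
  ... | no _     = ≤-refl

  post-fixed-rename : ∀ {n m} (κ : Fin m → Fin n) (cmd : Command L m)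
                      (ρ : Valuation L n) →
                      _⊑ᵥ_ L (⟦_⟧ L (rename L κ cmd) ρ) ρ →
                      _⊑ᵥ_ L (⟦_⟧ L cmd (ρ ∘ κ)) (ρ ∘ κ)
  post-fixed-rename κ cmd@(⟨_⨾_⨾_⟩ ins f X) ρ post =
    output-bound⇒post-fixed cmd (ρ ∘ κ)
      (subst (λ v → f v ≤ ρ (κ X)) (sym (map-∘ ρ κ ins))
        (post-fixed⇒output-bound (rename L κ cmd) ρ post))

  post-fixed-unfolding : (P P' : Program L)
                         (κ : Fin (nVars P') → Fin (nVars P)) →
                         IsUnfolding L P P' κ →
                         (ρ : Valuation L (nVars P)) →
                         PostFixed L P ρ → PostFixed L P' (ρ ∘ κ)
  post-fixed-unfolding P P' κ unfolds ρ post {cmd'} cmd'∈P' =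
    post-fixed-rename κ cmd' ρ (post (unfolds cmd'∈P'))

  MFP-lower : (P : Program L) (ρ : Valuation L (nVars P)) →
              PostFixed L P ρ → _⊑ᵥ_ L (MFP L P) ρ
  MFP-lower P ρ post X = ⨅-lower _ (ρ , λ {cmd} → post {cmd})

  MFP-greatest : (P : Program L) (X : Fin (nVars P)) (a : Carrier) →
                 (∀ ρ → PostFixed L P ρ → a ≤ ρ X) → a ≤ MFP L P X
  MFP-greatest P X a below =
    ⨅-greatest _ a λ { (ρ , post) → below ρ (λ {cmd} → post {cmd}) }

  κ⃗-least : ∀ {n m} (κ : Fin m → Fin n) (ρ' : Valuation L m)
            (σ : Valuation L n) →
            _⊑ᵥ_ L ρ' (σ ∘ κ) → _⊑ᵥ_ L (κ⃗ L κ ρ') σ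
  κ⃗-least κ ρ' σ ρ'⊑σκ X =
    ⨆-least _ _ λ { (lift (X' , refl)) → ρ'⊑σκ X' }

mainTheorem3 : {c ℓ₁ ℓ₂ : Level} (L : CompleteLattice c ℓ₁ ℓ₂)
               (P : Program L) → WellFormed L P →
               (P' : Program L) → WellFormed L P' →
               (κ : Fin (nVars P') → Fin (nVars P)) →
               IsUnfolding L P P' κ →
               _⊑ᵥ_ L (κ⃗ L κ (MFP L P')) (MFP L P)
mainTheorem3 L P _ P' _ κ unfolds =
  κ⃗-least L κ (MFP L P') (MFP L P) MFP'-below-pullback
  where
    MFP'-below-pullback : _⊑ᵥ_ L (MFP L P') (MFP L P ∘ κ)
    MFP'-below-pullback X' =
      MFP-greatest L P (κ X') (MFP L P' X') λ ρ post →
        MFP-lower L P' (ρ ∘ κ)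
          (post-fixed-unfolding L P P' κ unfolds ρ post) X'
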